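{- For $\alpha\in\mathbb{C}$ define the formal power series in $(x-1)$ \[ T_\alpha(x)=\sum_{k=0}^{\infty} c_{\alpha|k}(x-1)^k,\qquad c_{\alpha|0}=1,\quad c_{\alpha|k+1}=\frac{1}{(k+1)!\,(2k+1)!!}\prod_{i=0}^{k}\left(\alpha^2-i^2\right)\ (k\ge 0). \] Then for all $\alpha,\beta\in\mathbb{C}$, \[ T_\alpha\big(T_\beta(x)\big)=T_{\alpha\beta}(x) \] as formal power series in $x-1$ (the composition is well defined since $T_\beta(x)-1$ has no constant term). In particular $T_1(x)=x$ and, for $\alpha\neq 0$, $T_\alpha$ has compositional inverse $T_{1/\alpha}$.
   Context: For $\alpha=n\in\mathbb{N}$, $T_n$ is the Chebyshev polynomial of the first kind, $T_n(\cos\theta)=\cos(n\theta)$; in general $T_\alpha$ is the unique power-series solution in $x-1$ of $(1-x^2)T''-xT'+\alpha^2T=0$ with $T(1)=1$. -}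

module Defs where

open import Level using (Level; _⊔_)
open import Data.Nat as ℕ using (ℕ; zero; suc)
open import Data.Nat.Base using (_!)
open import Relation.Nullary using (¬_)
open import Algebra.Bundles using (CommutativeRing; Semiring)
import Algebra.Definitions.RawSemiring as RS

-- A field of characteristic zero (the stdlib has no Field bundle).
-- ℂ is the intended instance.
record CharZeroField (c ℓ : Level) : Set (Level.suc (c ⊔ ℓ)) where
  field
    commutativeRing : CommutativeRing c ℓ
  open CommutativeRing commutativeRing public
  open RS (Semiring.rawSemiring semiring) using (_×_)
  field
    0≉1      : ¬ (0# ≈ 1#)
    _⁻¹⟨_⟩   : (x : Carrier) → ¬ (x ≈ 0#) → Carrier
    inverseʳ : (x : Carrier) (p : ¬ (x ≈ 0#)) → (x * (x ⁻¹⟨ p ⟩)) ≈ 1#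
    charZero : (n : ℕ) → ¬ ((suc n × 1#) ≈ 0#)

module Series {c ℓ : Level} (F : CharZeroField c ℓ) where
  open CharZeroField F
  open RS (Semiring.rawSemiring semiring) using (_×_)

  ⟦_⟧ : ℕ → Carrier
  ⟦ n ⟧ = n × 1#

  -- 1/m for m ≥ 1 (value at m = 0 is an irrelevant junk value 0#, never used)
  invℕ : ℕ → Carrier
  invℕ zero    = 0#
  invℕ (suc n) = ⟦ suc n ⟧ ⁻¹⟨ charZero n ⟩

  -- (2k+1)!! = ∏_{i=0}^{k} (2i+1)
  oddFact : ℕ → ℕ
  oddFact zero    = 1
  oddFact (suc k) = oddFact k ℕ.* (1 ℕ.+ 2 ℕ.* suc k)

  Σ< : ℕ → (ℕ → Carrier) → Carrier
  Σ< zero    f = 0#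
  Σ< (suc n) f = Σ< n f + f n

  Π< : ℕ → (ℕ → Carrier) → Carrier
  Π< zero    f = 1#
  Π< (suc n) f = Π< n f * f n

  -- formal power series in (x - 1): coefficient sequences
  PowerSeries : Set c
  PowerSeries = ℕ → Carrier

  _≋_ : PowerSeries → PowerSeries → Set ℓ
  f ≋ g = (n : ℕ) → f n ≈ g n

  _·_ : PowerSeries → PowerSeries → PowerSeries
  (f · g) n = Σ< (suc n) (λ i → f i * g (n ℕ.∸ i))

  one : PowerSeries
  one zero    = 1#
  one (suc n) = 0#

  _^ˢ_ : PowerSeries → ℕ → PowerSeries
  f ^ˢ zero  = one
  f ^ˢ suc k = (f ^ˢ k) · f

  minusConst : PowerSeries → PowerSeries
  minusConst g zero    = 0#
  minusConst g (suc n) = g (suc n)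

  -- composition f(g(x)) for series in (x-1) where g(1) = 1:
  -- f(g) = Σ_k f_k (g - 1)^k ; the n-th coefficient only involves k ≤ n.
  _∘ˢ_ : PowerSeries → PowerSeries → PowerSeries
  (f ∘ˢ g) n = Σ< (suc n) (λ k → f k * ((minusConst g ^ˢ k) n))

  -- the series x = 1 + (x - 1)
  X : PowerSeries
  X zero          = 1#
  X (suc zero)    = 1#
  X (suc (suc n)) = 0#

  coeff : Carrier → ℕ → Carrier
  coeff α zero    = 1#
  coeff α (suc k) =
    invℕ ((suc k) ! ℕ.* oddFact k) * Π< (suc k) (λ i → α * α - ⟦ i ⟧ * ⟦ i ⟧)

  T : Carrier → PowerSeries
  T α = coeff α

{-# OPTIONS --safe #-}

-- T α is the unique series with constant term 1 solving the Chebyshev equation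
-- (x² − 1) S″ + x S′ = α² S: in powers of x − 1 this is the recurrence
-- (n + 1)(2n + 1) c (n + 1) = (α² − n²) c n, which determines c (n + 1) in
-- characteristic 0. For u = T β, differentiating gives the first integral
-- (x² − 1) u′² = β² (u² − 1), and with the chain rule, for f = T α,
--   (x² − 1) (f ∘ u)″ + x (f ∘ u)′
--     = (f″ ∘ u) (x² − 1) u′² + (f′ ∘ u) ((x² − 1) u″ + x u′)
--     = β² (((x² − 1) f″ + x f′) ∘ u) = α² β² (f ∘ u).
-- Hence T α ∘ T β = T (α β) by uniqueness; and x solves the equation for α = 1.

module Submission where

open import Defs
open import Level using (Level)
open import Data.Product using (_×_; _,_)
open import Data.Nat as ℕ using (ℕ; zero; suc; _≤_; _<_; z≤n; s≤s; _∸_; NonZero; _!)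
import Data.Nat.Properties as ℕ
open import Data.Sum using (inj₁; inj₂)
open import Relation.Nullary using (¬_; yes; no)
open import Relation.Binary.PropositionalEquality as ≡ using (_≡_)
open import Data.Nat.Tactic.RingSolver using (solve-∀)
open import Algebra.Bundles using (CommutativeSemiring)
open import Algebra.Structures.Biased using (IsCommutativeSemiringˡ; IsCommutativeMonoidˡ)
open import Relation.Binary.Structures using (IsEquivalence)
import Algebra.Properties.Semiring.Mult as SemiringMult
import Algebra.Properties.Ring as RingProperties
import Relation.Binary.Reasoning.Setoid as SetoidReasoning

module Arithmetic {c ℓ : Level} (F : CharZeroField c ℓ) where
  open CharZeroField F
  open Series F
  open SemiringMult semiring using (×-homo-+; ×1-homo-*)
  open RingProperties ring using (x[y-z]≈xy-xz)
  open import Algebra.Properties.CommutativeSemigroup *-commutativeSemigroup using (interchange)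
  open SetoidReasoning setoid

  ⟦⟧-+ : ∀ m n → ⟦ m ℕ.+ n ⟧ ≈ ⟦ m ⟧ + ⟦ n ⟧
  ⟦⟧-+ = ×-homo-+ 1#

  ⟦⟧-* : ∀ m n → ⟦ m ℕ.* n ⟧ ≈ ⟦ m ⟧ * ⟦ n ⟧
  ⟦⟧-* = ×1-homo-*

  ⟦⟧-cong : ∀ {m n} → m ≡ n → ⟦ m ⟧ ≈ ⟦ n ⟧
  ⟦⟧-cong ≡.refl = refl

  ⟦⟧≉0 : ∀ n .{{_ : NonZero n}} → ¬ ⟦ n ⟧ ≈ 0#
  ⟦⟧≉0 (suc n) = charZero n

  ⟦⟧*invℕ : ∀ n .{{_ : NonZero n}} → ⟦ n ⟧ * invℕ n ≈ 1#
  ⟦⟧*invℕ (suc n) = inverseʳ ⟦ suc n ⟧ (charZero n)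

  *-cancelˡ-≉0 : ∀ {x a b} → ¬ x ≈ 0# → x * a ≈ x * b → a ≈ b
  *-cancelˡ-≉0 {x} {a} {b} x≉0 xa≈xb = begin
    a                   ≈⟨ cancel a ⟨
    x⁻¹ * x * a         ≈⟨ *-assoc _ _ _ ⟩
    x⁻¹ * (x * a)       ≈⟨ *-congˡ xa≈xb ⟩
    x⁻¹ * (x * b)       ≈⟨ *-assoc _ _ _ ⟨
    x⁻¹ * x * b         ≈⟨ cancel b ⟩
    b                   ∎
    where
    x⁻¹ = x ⁻¹⟨ x≉0 ⟩
    cancel : ∀ y → x⁻¹ * x * y ≈ y
    cancel y = trans (*-congʳ (trans (*-comm _ _) (inverseʳ x x≉0))) (*-identityˡ y)

  x[y-z]+zx≈yx : ∀ x y z → x * (y - z) + z * x ≈ y * x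
  x[y-z]+zx≈yx x y z = begin
    x * (y - z) + z * x          ≈⟨ +-cong (x[y-z]≈xy-xz x y z) (*-comm z x) ⟩
    x * y - x * z + x * z        ≈⟨ +-assoc _ _ _ ⟩
    x * y + (- (x * z) + x * z)  ≈⟨ +-congˡ (-‿inverseˡ (x * z)) ⟩
    x * y + 0#                   ≈⟨ +-identityʳ _ ⟩
    x * y                        ≈⟨ *-comm x y ⟩
    y * x                        ∎

  ⟦⟧*invℕ-* : ∀ m n .{{_ : NonZero m}} .{{_ : NonZero n}} → ⟦ m ⟧ * invℕ (m ℕ.* n) ≈ invℕ n
  ⟦⟧*invℕ-* m n = begin
    ⟦ m ⟧ * invℕ (m ℕ.* n)                            ≈⟨ *-identityʳ _ ⟨
    ⟦ m ⟧ * invℕ (m ℕ.* n) * 1#                       ≈⟨ *-congˡ (⟦⟧*invℕ n) ⟨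
    ⟦ m ⟧ * invℕ (m ℕ.* n) * (⟦ n ⟧ * invℕ n)          ≈⟨ interchange _ _ _ _ ⟩
    ⟦ m ⟧ * ⟦ n ⟧ * (invℕ (m ℕ.* n) * invℕ n)         ≈⟨ *-assoc _ _ _ ⟨
    ⟦ m ⟧ * ⟦ n ⟧ * invℕ (m ℕ.* n) * invℕ n           ≈⟨ *-congʳ (*-congʳ (⟦⟧-* m n)) ⟨
    ⟦ m ℕ.* n ⟧ * invℕ (m ℕ.* n) * invℕ n             ≈⟨ *-congʳ (⟦⟧*invℕ (m ℕ.* n) {{ℕ.m*n≢0 m n}}) ⟩
    1# * invℕ n                                       ≈⟨ *-identityˡ _ ⟩
    invℕ n                                            ∎

module FiniteSums {c ℓ : Level} (F : CharZeroField c ℓ) where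
  open CharZeroField F
  open Series F
  open SetoidReasoning setoid

  Σ<-cong : ∀ n {f g} → (∀ i → i < n → f i ≈ g i) → Σ< n f ≈ Σ< n g
  Σ<-cong zero    eq = refl
  Σ<-cong (suc n) eq = +-cong (Σ<-cong n (λ i i<n → eq i (ℕ.m<n⇒m<1+n i<n))) (eq n (ℕ.n<1+n n))

  Σ<-zero : ∀ n {f} → (∀ i → i < n → f i ≈ 0#) → Σ< n f ≈ 0#
  Σ<-zero zero    eq = refl
  Σ<-zero (suc n) eq = trans (+-cong (Σ<-zero n (λ i i<n → eq i (ℕ.m<n⇒m<1+n i<n))) (eq n (ℕ.n<1+n n))) (+-identityˡ 0#)

  Σ<-distrib-+ : ∀ n (f g : ℕ → Carrier) → Σ< n (λ i → f i + g i) ≈ Σ< n f + Σ< n g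
  Σ<-distrib-+ zero    f g = sym (+-identityˡ 0#)
  Σ<-distrib-+ (suc n) f g = trans (+-congʳ (Σ<-distrib-+ n f g)) (interchange _ _ _ _)
    where open import Algebra.Properties.CommutativeSemigroup +-commutativeSemigroup using (interchange)

  *-distribˡ-Σ< : ∀ n a (f : ℕ → Carrier) → a * Σ< n f ≈ Σ< n (λ i → a * f i)
  *-distribˡ-Σ< zero    a f = zeroʳ a
  *-distribˡ-Σ< (suc n) a f = trans (distribˡ a _ _) (+-congʳ (*-distribˡ-Σ< n a f))

  *-distribʳ-Σ< : ∀ n a (f : ℕ → Carrier) → Σ< n f * a ≈ Σ< n (λ i → f i * a)
  *-distribʳ-Σ< zero    a f = zeroˡ a
  *-distribʳ-Σ< (suc n) a f = trans (distribʳ a _ _) (+-congʳ (*-distribʳ-Σ< n a f))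

  Σ<-suc : ∀ n (f : ℕ → Carrier) → Σ< (suc n) f ≈ f 0 + Σ< n (λ i → f (suc i))
  Σ<-suc zero    f = trans (+-identityˡ _) (sym (+-identityʳ _))
  Σ<-suc (suc n) f = trans (+-congʳ (Σ<-suc n f)) (+-assoc _ _ _)

  Σ<-comm : ∀ m n (f : ℕ → ℕ → Carrier) → Σ< m (λ i → Σ< n (f i)) ≈ Σ< n (λ j → Σ< m (λ i → f i j))
  Σ<-comm zero    n f = sym (Σ<-zero n (λ _ _ → refl))
  Σ<-comm (suc m) n f = trans (+-congʳ (Σ<-comm m n f)) (sym (Σ<-distrib-+ n _ _))

  Σ<-reverse : ∀ n (f : ℕ → Carrier) → Σ< n f ≈ Σ< n (λ i → f (n ∸ suc i))
  Σ<-reverse zero    f = refl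
  Σ<-reverse (suc n) f = begin
    Σ< n f + f n                              ≈⟨ +-comm _ _ ⟩
    f n + Σ< n f                              ≈⟨ +-congˡ (Σ<-reverse n f) ⟩
    f n + Σ< n (λ i → f (n ∸ suc i))          ≈⟨ Σ<-suc n (λ i → f (n ∸ i)) ⟨
    Σ< (suc n) (λ i → f (suc n ∸ suc i))      ∎

  Σ<-extend : ∀ {m} n (f : ℕ → Carrier) → m ≤ n → (∀ i → m ≤ i → f i ≈ 0#) → Σ< n f ≈ Σ< m f
  Σ<-extend zero    f z≤n vanish = refl
  Σ<-extend (suc n) f m≤1+n vanish with ℕ.m≤n⇒m<n∨m≡n m≤1+n
  ... | inj₂ ≡.refl = refl
  ... | inj₁ (s≤s m≤n) = trans (+-cong (Σ<-extend n f m≤n vanish) (vanish n m≤n)) (+-identityʳ _)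

  Σ<-triangle : ∀ n (f : ℕ → ℕ → Carrier) →
    Σ< (suc n) (λ m → Σ< (suc m) (f m)) ≈ Σ< (suc n) (λ i → Σ< (suc (n ∸ i)) (λ j → f (i ℕ.+ j) i))
  Σ<-triangle zero    f = refl
  Σ<-triangle (suc n) f = begin
    Σ< (suc n) (λ m → Σ< (suc m) (f m)) + Σ< (suc (suc n)) (f (suc n))
      ≈⟨ +-cong (Σ<-triangle n f) (Σ<-cong (suc (suc n)) λ i i≤1+n →
           reflexive (≡.cong (λ k → f k i) (≡.sym (ℕ.m+[n∸m]≡n (ℕ.≤-pred i≤1+n))))) ⟩
    Σ< (suc n) inner + (Σ< (suc n) diagonal + f (suc n ℕ.+ (suc n ∸ suc n)) (suc n))
      ≈⟨ +-assoc _ _ _ ⟨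
    Σ< (suc n) inner + Σ< (suc n) diagonal + f (suc n ℕ.+ (n ∸ n)) (suc n)
      ≈⟨ +-cong (sym (Σ<-distrib-+ (suc n) inner diagonal)) (corner (n ∸ n) (ℕ.n∸n≡0 n)) ⟩
    Σ< (suc n) (λ i → inner i + diagonal i) + Σ< (suc (n ∸ n)) (λ j → f (suc n ℕ.+ j) (suc n))
      ≈⟨ +-congʳ (Σ<-cong (suc n) λ i i≤n →
           +-congʳ (reflexive (≡.cong (λ k → Σ< k (λ j → f (i ℕ.+ j) i)) (≡.sym (ℕ.+-∸-assoc 1 (ℕ.≤-pred i≤n)))))) ⟩
    Σ< (suc n) (λ i → Σ< (suc (suc n ∸ i)) (λ j → f (i ℕ.+ j) i)) + Σ< (suc (n ∸ n)) (λ j → f (suc n ℕ.+ j) (suc n))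
      ∎
    where
    inner diagonal : ℕ → Carrier
    inner i = Σ< (suc (n ∸ i)) (λ j → f (i ℕ.+ j) i)
    diagonal i = f (i ℕ.+ (suc n ∸ i)) i
    corner : ∀ k → k ≡ 0 → f (suc n ℕ.+ k) (suc n) ≈ Σ< (suc k) (λ j → f (suc n ℕ.+ j) (suc n))
    corner _ ≡.refl = sym (+-identityˡ _)

module PowerSeriesSemiring {c ℓ : Level} (F : CharZeroField c ℓ) where
  open CharZeroField F
  open Series F
  open FiniteSums F
  open SetoidReasoning setoid

  infixl 6 _+ˢ_

  _+ˢ_ : PowerSeries → PowerSeries → PowerSeries
  (f +ˢ g) n = f n + g n

  0ˢ : PowerSeries
  0ˢ n = 0#

  constˢ : Carrier → PowerSeries
  constˢ a zero    = a
  constˢ a (suc n) = 0#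

  ≋-isEquivalence : IsEquivalence _≋_
  ≋-isEquivalence = record
    { refl  = λ n → refl
    ; sym   = λ f≋g n → sym (f≋g n)
    ; trans = λ f≋g g≋h n → trans (f≋g n) (g≋h n)
    }

  +ˢ-cong : ∀ {f f′ g g′} → f ≋ f′ → g ≋ g′ → (f +ˢ g) ≋ (f′ +ˢ g′)
  +ˢ-cong f≋f′ g≋g′ n = +-cong (f≋f′ n) (g≋g′ n)

  ·-cong : ∀ {f f′ g g′} → f ≋ f′ → g ≋ g′ → (f · g) ≋ (f′ · g′)
  ·-cong f≋f′ g≋g′ n = Σ<-cong (suc n) (λ i _ → *-cong (f≋f′ i) (g≋g′ (n ∸ i)))

  ·-comm : ∀ f g → (f · g) ≋ (g · f)
  ·-comm f g n = begin
    Σ< (suc n) (λ i → f i * g (n ∸ i))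
      ≈⟨ Σ<-reverse (suc n) _ ⟩
    Σ< (suc n) (λ i → f (n ∸ i) * g (n ∸ (n ∸ i)))
      ≈⟨ Σ<-cong (suc n) (λ i i≤n → trans (*-comm _ _) (*-congʳ (reflexive (≡.cong g (ℕ.m∸[m∸n]≡n (ℕ.≤-pred i≤n)))))) ⟩
    Σ< (suc n) (λ i → g i * f (n ∸ i))
      ∎

  ·-assoc : ∀ f g h → ((f · g) · h) ≋ (f · (g · h))
  ·-assoc f g h n = begin
    Σ< (suc n) (λ m → Σ< (suc m) (λ i → f i * g (m ∸ i)) * h (n ∸ m))
      ≈⟨ Σ<-cong (suc n) (λ m _ → *-distribʳ-Σ< (suc m) _ _) ⟩
    Σ< (suc n) (λ m → Σ< (suc m) (λ i → f i * g (m ∸ i) * h (n ∸ m)))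
      ≈⟨ Σ<-triangle n (λ m i → f i * g (m ∸ i) * h (n ∸ m)) ⟩
    Σ< (suc n) (λ i → Σ< (suc (n ∸ i)) (λ j → f i * g (i ℕ.+ j ∸ i) * h (n ∸ (i ℕ.+ j))))
      ≈⟨ Σ<-cong (suc n) (λ i _ → Σ<-cong (suc (n ∸ i)) (λ j _ → trans (*-assoc _ _ _) (*-congˡ (*-cong
           (reflexive (≡.cong g (ℕ.m+n∸m≡n i j))) (reflexive (≡.cong h (≡.sym (ℕ.∸-+-assoc n i j)))))))) ⟩
    Σ< (suc n) (λ i → Σ< (suc (n ∸ i)) (λ j → f i * (g j * h (n ∸ i ∸ j))))
      ≈⟨ Σ<-cong (suc n) (λ i _ → *-distribˡ-Σ< (suc (n ∸ i)) _ _) ⟨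
    Σ< (suc n) (λ i → f i * Σ< (suc (n ∸ i)) (λ j → g j * h (n ∸ i ∸ j)))
      ∎

  ·-distribʳ : ∀ h f g → ((f +ˢ g) · h) ≋ ((f · h) +ˢ (g · h))
  ·-distribʳ h f g n = trans (Σ<-cong (suc n) (λ i _ → distribʳ _ _ _)) (Σ<-distrib-+ (suc n) _ _)

  constˢ-· : ∀ a f → (constˢ a · f) ≋ (λ n → a * f n)
  constˢ-· a f n = begin
    (constˢ a · f) n                          ≈⟨ Σ<-suc n _ ⟩
    a * f n + Σ< n (λ i → 0# * f (n ∸ suc i)) ≈⟨ +-congˡ (Σ<-zero n (λ i _ → zeroˡ _)) ⟩
    a * f n + 0#                              ≈⟨ +-identityʳ _ ⟩
    a * f n                                   ∎

  constˢ-cong : ∀ {a b} → a ≈ b → constˢ a ≋ constˢ b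
  constˢ-cong a≈b zero    = a≈b
  constˢ-cong a≈b (suc n) = refl

  one≋constˢ1# : one ≋ constˢ 1#
  one≋constˢ1# zero    = refl
  one≋constˢ1# (suc n) = refl

  ·-identityˡ : ∀ f → (one · f) ≋ f
  ·-identityˡ f n = trans (·-cong {g = f} one≋constˢ1# (λ _ → refl) n) (trans (constˢ-· 1# f n) (*-identityˡ (f n)))

  ·-zeroˡ : ∀ f → (0ˢ · f) ≋ 0ˢ
  ·-zeroˡ f n = Σ<-zero (suc n) (λ i _ → zeroˡ _)

  powerSeriesSemiring : CommutativeSemiring c ℓ
  powerSeriesSemiring = record
    { Carrier = PowerSeries
    ; _≈_ = _≋_
    ; _+_ = _+ˢ_
    ; _*_ = _·_
    ; 0# = 0ˢ
    ; 1# = one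
    ; isCommutativeSemiring = IsCommutativeSemiringˡ.isCommutativeSemiring record
      { +-isCommutativeMonoid = record
        { isMonoid = record
          { isSemigroup = record
            { isMagma = record { isEquivalence = ≋-isEquivalence ; ∙-cong = +ˢ-cong }
            ; assoc = λ f g h n → +-assoc (f n) (g n) (h n)
            }
          ; identity = (λ f n → +-identityˡ (f n)) , (λ f n → +-identityʳ (f n))
          }
        ; comm = λ f g n → +-comm (f n) (g n)
        }
      ; *-isCommutativeMonoid = IsCommutativeMonoidˡ.isCommutativeMonoid record
        { isSemigroup = record
          { isMagma = record { isEquivalence = ≋-isEquivalence ; ∙-cong = ·-cong }
          ; assoc = ·-assoc
          }
        ; identityˡ = ·-identityˡ
        ; comm = ·-comm
        }
      ; distribʳ = ·-distribʳ
      ; zeroˡ = ·-zeroˡ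
      }
    }

  module PS = CommutativeSemiring powerSeriesSemiring
  module ≋-Reasoning = SetoidReasoning PS.setoid

  -- The fixed operand is explicit: series are functions, which Agda compares
  -- pointwise, so it cannot be recovered by unification.
  +ˢ-congˡ : ∀ f {g g′} → g ≋ g′ → (f +ˢ g) ≋ (f +ˢ g′)
  +ˢ-congˡ f = +ˢ-cong {f} (λ n → refl)

  +ˢ-congʳ : ∀ g {f f′} → f ≋ f′ → (f +ˢ g) ≋ (f′ +ˢ g)
  +ˢ-congʳ g f≋f′ = +ˢ-cong {g = g} f≋f′ (λ n → refl)

  ·-congˡ : ∀ f {g g′} → g ≋ g′ → (f · g) ≋ (f · g′)
  ·-congˡ f = ·-cong {f} (λ n → refl)

  ·-congʳ : ∀ g {f f′} → f ≋ f′ → (f · g) ≋ (f′ · g)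
  ·-congʳ g f≋f′ = ·-cong {g = g} f≋f′ (λ n → refl)

module Differentiation {c ℓ : Level} (F : CharZeroField c ℓ) where
  open CharZeroField F
  open Series F
  open Arithmetic F
  open FiniteSums F
  open PowerSeriesSemiring F
  open import Algebra.Properties.CommutativeSemigroup *-commutativeSemigroup using (x∙yz≈y∙xz)
  open import Algebra.Solver.Ring.NaturalCoefficients.Default powerSeriesSemiring
    using (solve; _:=_; _:+_; _:*_; con)

  D : PowerSeries → PowerSeries
  D f n = ⟦ suc n ⟧ * f (suc n)

  Y : PowerSeries
  Y zero    = 0#
  Y (suc n) = one n

  X≋one+Y : X ≋ (one +ˢ Y)
  X≋one+Y zero          = sym (+-identityʳ 1#)
  X≋one+Y (suc zero)    = sym (+-identityˡ 1#)
  X≋one+Y (suc (suc n)) = sym (+-identityˡ 0#)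

  Y·-zero : ∀ f → (Y · f) 0 ≈ 0#
  Y·-zero f = trans (+-identityˡ _) (zeroˡ _)

  Y·-suc : ∀ f n → (Y · f) (suc n) ≈ f n
  Y·-suc f n = begin
    (Y · f) (suc n)                ≈⟨ Σ<-suc (suc n) _ ⟩
    0# * f (suc n) + (one · f) n   ≈⟨ +-cong (zeroˡ _) (·-identityˡ f n) ⟩
    0# + f n                       ≈⟨ +-identityˡ _ ⟩
    f n                            ∎
    where open SetoidReasoning setoid

  Y·D-coefficient : ∀ f n → (Y · D f) n ≈ ⟦ n ⟧ * f n
  Y·D-coefficient f zero    = trans (Y·-zero (D f)) (sym (zeroˡ (f 0)))
  Y·D-coefficient f (suc n) = Y·-suc (D f) n

  D-cong : ∀ {f g} → f ≋ g → D f ≋ D g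
  D-cong f≋g n = *-congˡ (f≋g (suc n))

  D-+ˢ : ∀ f g → D (f +ˢ g) ≋ (D f +ˢ D g)
  D-+ˢ f g n = distribˡ _ _ _

  D-constˢ : ∀ a → D (constˢ a) ≋ 0ˢ
  D-constˢ a n = zeroʳ _

  D-one : D one ≋ 0ˢ
  D-one n = zeroʳ _

  D-Y : D Y ≋ one
  D-Y zero    = trans (*-identityʳ _) (+-identityʳ 1#)
  D-Y (suc n) = zeroʳ _

  D-X : D X ≋ one
  D-X zero    = trans (*-identityʳ _) (+-identityʳ 1#)
  D-X (suc n) = zeroʳ _

  D-· : ∀ f g → D (f · g) ≋ ((D f · g) +ˢ (f · D g))
  D-· f g n = begin
    ⟦ suc n ⟧ * Σ< (suc (suc n)) (λ i → f i * g (suc n ∸ i))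
      ≈⟨ *-distribˡ-Σ< (suc (suc n)) _ _ ⟩
    Σ< (suc (suc n)) (λ i → ⟦ suc n ⟧ * (f i * g (suc n ∸ i)))
      ≈⟨ Σ<-cong (suc (suc n)) (λ i i≤1+n → trans (*-congʳ (split i (ℕ.≤-pred i≤1+n))) (distribʳ _ _ _)) ⟩
    Σ< (suc (suc n)) (λ i → ⟦ i ⟧ * (f i * g (suc n ∸ i)) + ⟦ suc n ∸ i ⟧ * (f i * g (suc n ∸ i)))
      ≈⟨ Σ<-distrib-+ (suc (suc n)) _ _ ⟩
    Σ< (suc (suc n)) (λ i → ⟦ i ⟧ * (f i * g (suc n ∸ i))) + Σ< (suc (suc n)) (λ i → ⟦ suc n ∸ i ⟧ * (f i * g (suc n ∸ i)))
      ≈⟨ +-cong differentiate-f differentiate-g ⟩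
    (D f · g) n + (f · D g) n ∎
    where
    open SetoidReasoning setoid
    split : ∀ i → i ≤ suc n → ⟦ suc n ⟧ ≈ ⟦ i ⟧ + ⟦ suc n ∸ i ⟧
    split i i≤1+n = trans (⟦⟧-cong (≡.sym (ℕ.m+[n∸m]≡n i≤1+n))) (⟦⟧-+ i (suc n ∸ i))
    differentiate-f : Σ< (suc (suc n)) (λ i → ⟦ i ⟧ * (f i * g (suc n ∸ i))) ≈ (D f · g) n
    differentiate-f = begin
      Σ< (suc (suc n)) (λ i → ⟦ i ⟧ * (f i * g (suc n ∸ i)))
        ≈⟨ Σ<-suc (suc n) _ ⟩
      0# * (f 0 * g (suc n)) + Σ< (suc n) (λ i → ⟦ suc i ⟧ * (f (suc i) * g (n ∸ i)))
        ≈⟨ +-cong (zeroˡ _) (Σ<-cong (suc n) (λ i _ → sym (*-assoc _ _ _))) ⟩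
      0# + (D f · g) n
        ≈⟨ +-identityˡ _ ⟩
      (D f · g) n ∎
    differentiate-g : Σ< (suc (suc n)) (λ i → ⟦ suc n ∸ i ⟧ * (f i * g (suc n ∸ i))) ≈ (f · D g) n
    differentiate-g = begin
      Σ< (suc n) (λ i → ⟦ suc n ∸ i ⟧ * (f i * g (suc n ∸ i))) + ⟦ suc n ∸ suc n ⟧ * (f (suc n) * g (suc n ∸ suc n))
        ≈⟨ +-cong (Σ<-cong (suc n) (λ i i≤n → term i (ℕ.≤-pred i≤n))) (trans (*-congʳ (⟦⟧-cong (ℕ.n∸n≡0 n))) (zeroˡ _)) ⟩
      (f · D g) n + 0#
        ≈⟨ +-identityʳ _ ⟩
      (f · D g) n ∎
      where
      term : ∀ i → i ≤ n → ⟦ suc n ∸ i ⟧ * (f i * g (suc n ∸ i)) ≈ f i * (⟦ suc (n ∸ i) ⟧ * g (suc (n ∸ i)))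
      term i i≤n rewrite ℕ.+-∸-assoc 1 i≤n = x∙yz≈y∙xz _ _ _

  constˢ-zero : constˢ 0# ≋ 0ˢ
  constˢ-zero zero    = refl
  constˢ-zero (suc n) = refl

  constˢ-suc : ∀ k → constˢ ⟦ suc k ⟧ ≋ (one +ˢ constˢ ⟦ k ⟧)
  constˢ-suc k zero    = refl
  constˢ-suc k (suc n) = sym (+-identityˡ 0#)

  D-^ : ∀ f k → D (f ^ˢ suc k) ≋ (constˢ ⟦ suc k ⟧ · ((f ^ˢ k) · D f))
  D-^ f zero = begin
    D (one · f)                             ≈⟨ D-· one f ⟩
    (D one · f) +ˢ (one · D f)              ≈⟨ +ˢ-congʳ (one · D f) (·-congʳ f D-one) ⟩
    (0ˢ · f) +ˢ (one · D f)                 ≈⟨ solve 2 (λ x e → con 0 :* x :+ e := (con 1 :+ con 0) :* e) PS.refl f (one · D f) ⟩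
    (one +ˢ 0ˢ) · (one · D f)               ≈⟨ ·-congʳ (one · D f) (PS.trans (+ˢ-congˡ one (PS.sym constˢ-zero)) (PS.sym (constˢ-suc 0))) ⟩
    constˢ ⟦ 1 ⟧ · (one · D f)              ∎
    where open ≋-Reasoning
  D-^ f (suc k) = begin
    D ((f ^ˢ suc k) · f)                                                ≈⟨ D-· (f ^ˢ suc k) f ⟩
    (D (f ^ˢ suc k) · f) +ˢ ((f ^ˢ suc k) · D f)                        ≈⟨ +ˢ-congʳ ((f ^ˢ suc k) · D f) (·-congʳ f (D-^ f k)) ⟩
    ((constˢ ⟦ suc k ⟧ · ((f ^ˢ k) · D f)) · f) +ˢ ((f ^ˢ suc k) · D f) ≈⟨ solve 4 (λ a p d x → a :* (p :* d) :* x :+ p :* x :* d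
                                                                                       := (con 1 :+ a) :* (p :* x :* d))
                                                                             PS.refl (constˢ ⟦ suc k ⟧) (f ^ˢ k) (D f) f ⟩
    (one +ˢ constˢ ⟦ suc k ⟧) · ((f ^ˢ suc k) · D f)                    ≈⟨ ·-congʳ ((f ^ˢ suc k) · D f) (PS.sym (constˢ-suc (suc k))) ⟩
    constˢ ⟦ suc (suc k) ⟧ · ((f ^ˢ suc k) · D f)                       ∎
    where open ≋-Reasoning

  D-injective : ∀ {f g} → D f ≋ D g → f 0 ≈ g 0 → f ≋ g
  D-injective Df≋Dg f₀≈g₀ zero    = f₀≈g₀
  D-injective Df≋Dg f₀≈g₀ (suc n) = *-cancelˡ-≉0 (⟦⟧≉0 (suc n)) (Df≋Dg n)

module Composition {c ℓ : Level} (F : CharZeroField c ℓ) where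
  open CharZeroField F
  open Series F
  open FiniteSums F
  open PowerSeriesSemiring F
  open Differentiation F
  open SetoidReasoning setoid
  open import Algebra.Properties.CommutativeSemigroup *-commutativeSemigroup using (x∙yz≈y∙xz)

  ∘ˢ-cong : ∀ {a b} g → a ≋ b → (a ∘ˢ g) ≋ (b ∘ˢ g)
  ∘ˢ-cong g a≋b n = Σ<-cong (suc n) (λ k _ → *-congʳ (a≋b k))

  ∘ˢ-+ˢ : ∀ a b g → ((a +ˢ b) ∘ˢ g) ≋ ((a ∘ˢ g) +ˢ (b ∘ˢ g))
  ∘ˢ-+ˢ a b g n = trans (Σ<-cong (suc n) (λ k _ → distribʳ _ _ _)) (Σ<-distrib-+ (suc n) _ _)

  ∘ˢ-zero : ∀ a g → (a ∘ˢ g) 0 ≈ a 0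
  ∘ˢ-zero a g = trans (+-identityˡ _) (*-identityʳ _)

  constˢ-·-∘ˢ : ∀ s a g → ((constˢ s · a) ∘ˢ g) ≋ (constˢ s · (a ∘ˢ g))
  constˢ-·-∘ˢ s a g n = begin
    ((constˢ s · a) ∘ˢ g) n                          ≈⟨ ∘ˢ-cong g (constˢ-· s a) n ⟩
    Σ< (suc n) (λ k → s * a k * (minusConst g ^ˢ k) n) ≈⟨ Σ<-cong (suc n) (λ k _ → *-assoc _ _ _) ⟩
    Σ< (suc n) (λ k → s * (a k * (minusConst g ^ˢ k) n)) ≈⟨ *-distribˡ-Σ< (suc n) s _ ⟨
    s * (a ∘ˢ g) n                                    ≈⟨ constˢ-· s (a ∘ˢ g) n ⟨
    (constˢ s · (a ∘ˢ g)) n                          ∎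

  minusConst-^-vanishes : ∀ g k n → n < k → (minusConst g ^ˢ k) n ≈ 0#
  minusConst-^-vanishes g (suc k) n n<1+k = Σ<-zero (suc n) (λ i i≤n → term i (ℕ.≤-pred i≤n))
    where
    term : ∀ i → i ≤ n → (minusConst g ^ˢ k) i * minusConst g (n ∸ i) ≈ 0#
    term i i≤n with i ℕ.<? k
    ... | yes i<k = trans (*-congʳ (minusConst-^-vanishes g k i i<k)) (zeroˡ _)
    ... | no  i≮k = trans (*-congˡ (reflexive (≡.cong (minusConst g) n∸i≡0))) (zeroʳ _)
      where
      n∸i≡0 : n ∸ i ≡ 0
      n∸i≡0 = ℕ.m≤n⇒m∸n≡0 (ℕ.≤-trans (ℕ.≤-pred n<1+k) (ℕ.≮⇒≥ i≮k))

  ∘ˢ-extend : ∀ a g n {N} → n < N → (a ∘ˢ g) n ≈ Σ< N (λ k → a k * (minusConst g ^ˢ k) n)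
  ∘ˢ-extend a g n n<N = sym (Σ<-extend _ _ n<N (λ k n<k → trans (*-congˡ (minusConst-^-vanishes g k n n<k)) (zeroʳ _)))

  ∘ˢ-·-coefficient : ∀ a g f n → ((a ∘ˢ g) · f) n ≈ Σ< (suc n) (λ k → a k * ((minusConst g ^ˢ k) · f) n)
  ∘ˢ-·-coefficient a g f n = begin
    Σ< (suc n) (λ i → (a ∘ˢ g) i * f (n ∸ i))
      ≈⟨ Σ<-cong (suc n) (λ i i≤n → *-congʳ (∘ˢ-extend a g i i≤n)) ⟩
    Σ< (suc n) (λ i → Σ< (suc n) (λ k → a k * (minusConst g ^ˢ k) i) * f (n ∸ i))
      ≈⟨ Σ<-cong (suc n) (λ i _ → trans (*-distribʳ-Σ< (suc n) _ _) (Σ<-cong (suc n) (λ k _ → *-assoc _ _ _))) ⟩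
    Σ< (suc n) (λ i → Σ< (suc n) (λ k → a k * ((minusConst g ^ˢ k) i * f (n ∸ i))))
      ≈⟨ Σ<-comm (suc n) (suc n) _ ⟩
    Σ< (suc n) (λ k → Σ< (suc n) (λ i → a k * ((minusConst g ^ˢ k) i * f (n ∸ i))))
      ≈⟨ Σ<-cong (suc n) (λ k _ → *-distribˡ-Σ< (suc n) (a k) _) ⟨
    Σ< (suc n) (λ k → a k * ((minusConst g ^ˢ k) · f) n)
      ∎

  Y·-∘ˢ : ∀ a g → ((Y · a) ∘ˢ g) ≋ ((a ∘ˢ g) · minusConst g)
  Y·-∘ˢ a g n = begin
    ((Y · a) ∘ˢ g) n
      ≈⟨ Σ<-suc n _ ⟩
    (Y · a) 0 * one n + Σ< n (λ k → (Y · a) (suc k) * (minusConst g ^ˢ suc k) n)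
      ≈⟨ +-cong (trans (*-congʳ (Y·-zero a)) (zeroˡ _)) (Σ<-cong n (λ k _ → *-congʳ (Y·-suc a k))) ⟩
    0# + Σ< n (λ k → a k * (minusConst g ^ˢ suc k) n)
      ≈⟨ trans (+-identityˡ _) (sym (+-identityʳ _)) ⟩
    Σ< n (λ k → a k * (minusConst g ^ˢ suc k) n) + 0#
      ≈⟨ +-congˡ (trans (*-congˡ (minusConst-^-vanishes g (suc n) n (ℕ.n<1+n n))) (zeroʳ _)) ⟨
    Σ< (suc n) (λ k → a k * ((minusConst g ^ˢ k) · minusConst g) n)
      ≈⟨ ∘ˢ-·-coefficient a g (minusConst g) n ⟨
    ((a ∘ˢ g) · minusConst g) n
      ∎

  chain-rule : ∀ a g → D (a ∘ˢ g) ≋ ((D a ∘ˢ g) · D g)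
  chain-rule a g n = begin
    ⟦ suc n ⟧ * Σ< (suc (suc n)) (λ k → a k * h^ k (suc n))
      ≈⟨ *-distribˡ-Σ< (suc (suc n)) _ _ ⟩
    Σ< (suc (suc n)) (λ k → ⟦ suc n ⟧ * (a k * h^ k (suc n)))
      ≈⟨ Σ<-suc (suc n) _ ⟩
    ⟦ suc n ⟧ * (a 0 * one (suc n)) + Σ< (suc n) (λ k → ⟦ suc n ⟧ * (a (suc k) * h^ (suc k) (suc n)))
      ≈⟨ +-cong (trans (*-congˡ (zeroʳ _)) (zeroʳ _)) (Σ<-cong (suc n) (λ k _ → x∙yz≈y∙xz _ _ _)) ⟩
    0# + Σ< (suc n) (λ k → a (suc k) * D (h^ (suc k)) n)
      ≈⟨ +-identityˡ _ ⟩
    Σ< (suc n) (λ k → a (suc k) * D (h^ (suc k)) n)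
      ≈⟨ Σ<-cong (suc n) (λ k _ → *-congˡ (trans (D-^ (minusConst g) k n) (constˢ-· ⟦ suc k ⟧ (h^ k · D g) n))) ⟩
    Σ< (suc n) (λ k → a (suc k) * (⟦ suc k ⟧ * (h^ k · D g) n))
      ≈⟨ Σ<-cong (suc n) (λ k _ → trans (sym (*-assoc _ _ _)) (*-congʳ (*-comm _ _))) ⟩
    Σ< (suc n) (λ k → D a k * (h^ k · D g) n)
      ≈⟨ ∘ˢ-·-coefficient (D a) g (D g) n ⟨
    ((D a ∘ˢ g) · D g) n
      ∎
    where
    h^ : ℕ → PowerSeries
    h^ k = minusConst g ^ˢ k

module ChebyshevEquation {c ℓ : Level} (F : CharZeroField c ℓ) where
  open CharZeroField F
  open Series F
  open Arithmetic F
  open PowerSeriesSemiring F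
  open Differentiation F

  -- Q (x − 1) = x² − 1.
  Q : PowerSeries → PowerSeries
  Q h = h · h +ˢ (h +ˢ h)

  -- The Chebyshev operator (x² − 1) S″ + x S′; Y is the series x − 1.
  L : PowerSeries → PowerSeries
  L S = Q Y · D (D S) +ˢ X · D S

  recurrenceFactor : ℕ → ℕ
  recurrenceFactor n = suc n ℕ.* suc (2 ℕ.* n)

  -- The Euler operator Y · D multiplies the n-th coefficient by n.
  L≋Euler-form : ∀ S → L S ≋ (Y · D (Y · D S) +ˢ ((Y · D (D S) +ˢ Y · D (D S)) +ˢ D S))
  L≋Euler-form S = begin
    Q Y · D (D S) +ˢ X · D S
      ≈⟨ +ˢ-congˡ (Q Y · D (D S)) (·-congʳ (D S) X≋one+Y) ⟩
    Q Y · D (D S) +ˢ (one +ˢ Y) · D S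
      ≈⟨ solve 3 (λ y s₁ s₂ → (y :* y :+ (y :+ y)) :* s₂ :+ (con 1 :+ y) :* s₁
                             := y :* (con 1 :* s₁ :+ y :* s₂) :+ ((y :* s₂ :+ y :* s₂) :+ s₁)) PS.refl Y (D S) (D (D S)) ⟩
    Y · (one · D S +ˢ Y · D (D S)) +ˢ ((Y · D (D S) +ˢ Y · D (D S)) +ˢ D S)
      ≈⟨ +ˢ-congʳ ((Y · D (D S) +ˢ Y · D (D S)) +ˢ D S)
                  (·-congˡ Y (PS.sym (PS.trans (D-· Y (D S)) (+ˢ-congʳ (Y · D (D S)) (·-congʳ (D S) D-Y))))) ⟩
    Y · D (Y · D S) +ˢ ((Y · D (D S) +ˢ Y · D (D S)) +ˢ D S)
      ∎
    where
    open ≋-Reasoning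
    open import Algebra.Solver.Ring.NaturalCoefficients.Default powerSeriesSemiring using (solve; _:=_; _:+_; _:*_; con)

  L-coefficient : ∀ S n → L S n ≈ ⟦ recurrenceFactor n ⟧ * S (suc n) + ⟦ n ⟧ * ⟦ n ⟧ * S n
  L-coefficient S n = begin
    L S n
      ≈⟨ L≋Euler-form S n ⟩
    (Y · D (Y · D S)) n + (((Y · D (D S)) n + (Y · D (D S)) n) + D S n)
      ≈⟨ +-cong (trans (Y·D-coefficient (Y · D S) n) (*-congˡ (Y·D-coefficient S n)))
                (+-congʳ (+-cong (Y·D-coefficient (D S) n) (Y·D-coefficient (D S) n))) ⟩
    ⟦ n ⟧ * (⟦ n ⟧ * S n) + ((⟦ n ⟧ * (⟦ suc n ⟧ * S (suc n)) + ⟦ n ⟧ * (⟦ suc n ⟧ * S (suc n))) + ⟦ suc n ⟧ * S (suc n))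
      ≈⟨ solve 3 (λ a s₀ s₁ → a :* (a :* s₀) :+ ((a :* ((con 1 :+ a) :* s₁) :+ a :* ((con 1 :+ a) :* s₁)) :+ (con 1 :+ a) :* s₁)
                           := (con 1 :+ a) :* (con 1 :+ (con 1 :+ (con 1 :+ con 0)) :* a) :* s₁ :+ a :* a :* s₀) refl ⟦ n ⟧ (S n) (S (suc n)) ⟩
    ⟦ suc n ⟧ * (1# + ⟦ 2 ⟧ * ⟦ n ⟧) * S (suc n) + ⟦ n ⟧ * ⟦ n ⟧ * S n
      ≈⟨ +-congʳ (*-congʳ (trans (⟦⟧-* (suc n) (suc (2 ℕ.* n))) (*-congˡ (+-congˡ (⟦⟧-* 2 n))))) ⟨
    ⟦ recurrenceFactor n ⟧ * S (suc n) + ⟦ n ⟧ * ⟦ n ⟧ * S n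
      ∎
    where
    open SetoidReasoning setoid
    open import Algebra.Solver.Ring.NaturalCoefficients.Default commutativeSemiring using (solve; _:=_; _:+_; _:*_; con)

  SolvesChebyshev : Carrier → PowerSeries → Set ℓ
  SolvesChebyshev γ S = L S ≋ (constˢ (γ * γ) · S)

  chebyshev-recurrence : ∀ γ S → SolvesChebyshev γ S →
    ∀ n → ⟦ recurrenceFactor n ⟧ * S (suc n) + ⟦ n ⟧ * ⟦ n ⟧ * S n ≈ γ * γ * S n
  chebyshev-recurrence γ S solves n = trans (sym (L-coefficient S n)) (trans (solves n) (constˢ-· (γ * γ) S n))

  chebyshev-unique : ∀ γ S S′ → SolvesChebyshev γ S → SolvesChebyshev γ S′ → S 0 ≈ S′ 0 → S ≋ S′
  chebyshev-unique γ S S′ solves solves′ S₀≈S′₀ zero    = S₀≈S′₀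
  chebyshev-unique γ S S′ solves solves′ S₀≈S′₀ (suc n) =
    *-cancelˡ-≉0 (⟦⟧≉0 (recurrenceFactor n)) (+-cancelʳ (⟦ n ⟧ * ⟦ n ⟧ * S n) _ _ (begin
      ⟦ recurrenceFactor n ⟧ * S (suc n) + ⟦ n ⟧ * ⟦ n ⟧ * S n   ≈⟨ chebyshev-recurrence γ S solves n ⟩
      γ * γ * S n                                               ≈⟨ *-congˡ Sₙ≈S′ₙ ⟩
      γ * γ * S′ n                                              ≈⟨ chebyshev-recurrence γ S′ solves′ n ⟨
      ⟦ recurrenceFactor n ⟧ * S′ (suc n) + ⟦ n ⟧ * ⟦ n ⟧ * S′ n ≈⟨ +-congˡ (*-congˡ Sₙ≈S′ₙ) ⟨
      ⟦ recurrenceFactor n ⟧ * S′ (suc n) + ⟦ n ⟧ * ⟦ n ⟧ * S n  ∎))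
    where
    open SetoidReasoning setoid
    open RingProperties ring using (+-cancelʳ)
    Sₙ≈S′ₙ : S n ≈ S′ n
    Sₙ≈S′ₙ = chebyshev-unique γ S S′ solves solves′ S₀≈S′₀ n

  SolvesChebyshev-cong : ∀ {γ γ′} S → γ ≈ γ′ → SolvesChebyshev γ S → SolvesChebyshev γ′ S
  SolvesChebyshev-cong S γ≈γ′ solves n = trans (solves n) (·-congʳ S (constˢ-cong (*-cong γ≈γ′ γ≈γ′)) n)

  X-solvesChebyshev : SolvesChebyshev 1# X
  X-solvesChebyshev = begin
    Q Y · D (D X) +ˢ X · D X    ≈⟨ PS.+-cong (·-congˡ (Q Y) (PS.trans (D-cong D-X) D-one)) (·-congˡ X D-X) ⟩
    Q Y · 0ˢ +ˢ X · one         ≈⟨ solve 2 (λ q x → q :* con 0 :+ x :* con 1 := con 1 :* x) PS.refl (Q Y) X ⟩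
    one · X                     ≈⟨ ·-congʳ X (PS.trans one≋constˢ1# (constˢ-cong (sym (*-identityˡ 1#)))) ⟩
    constˢ (1# * 1#) · X        ∎
    where
    open ≋-Reasoning
    open import Algebra.Solver.Ring.NaturalCoefficients.Default powerSeriesSemiring using (solve; _:=_; _:+_; _:*_; con)

module ChebyshevSeries {c ℓ : Level} (F : CharZeroField c ℓ) where
  open CharZeroField F
  open Series F
  open Arithmetic F
  open PowerSeriesSemiring F
  open ChebyshevEquation F
  open SetoidReasoning setoid

  denominator : ℕ → ℕ
  denominator k = suc k ! ℕ.* oddFact k

  oddFact≢0 : ∀ k → NonZero (oddFact k)
  oddFact≢0 zero    = _
  oddFact≢0 (suc k) = ℕ.m*n≢0 (oddFact k) _ {{oddFact≢0 k}}

  denominator≢0 : ∀ k → NonZero (denominator k)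
  denominator≢0 k = ℕ.m*n≢0 (suc k !) (oddFact k) {{suc k ℕ.!≢0}} {{oddFact≢0 k}}

  denominator-suc : ∀ k → denominator (suc k) ≡ recurrenceFactor (suc k) ℕ.* denominator k
  denominator-suc k = rearrange (suc (suc k)) (suc k !) (oddFact k) (suc (2 ℕ.* suc k))
    where
    rearrange : ∀ a b c d → a ℕ.* b ℕ.* (c ℕ.* d) ≡ a ℕ.* d ℕ.* (b ℕ.* c)
    rearrange = solve-∀

  module _ (γ : Carrier) where
    private
      d : ℕ → Carrier
      d i = γ * γ - ⟦ i ⟧ * ⟦ i ⟧

    T-step : ∀ n → ⟦ recurrenceFactor n ⟧ * T γ (suc n) ≈ T γ n * (γ * γ - ⟦ n ⟧ * ⟦ n ⟧)
    T-step zero = begin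
      ⟦ 1 ⟧ * (invℕ 1 * (1# * d 0))   ≈⟨ *-assoc _ _ _ ⟨
      ⟦ 1 ⟧ * invℕ 1 * (1# * d 0)     ≈⟨ trans (*-congʳ (⟦⟧*invℕ 1)) (*-identityˡ _) ⟩
      1# * d 0                        ∎
    T-step (suc k) = begin
      ⟦ recurrenceFactor (suc k) ⟧ * (invℕ (denominator (suc k)) * (Π< (suc k) d * d (suc k)))
        ≈⟨ *-assoc _ _ _ ⟨
      ⟦ recurrenceFactor (suc k) ⟧ * invℕ (denominator (suc k)) * (Π< (suc k) d * d (suc k))
        ≈⟨ *-congʳ (trans (reflexive (≡.cong (λ m → ⟦ recurrenceFactor (suc k) ⟧ * invℕ m) (denominator-suc k)))
                          (⟦⟧*invℕ-* (recurrenceFactor (suc k)) (denominator k) {{_}} {{denominator≢0 k}})) ⟩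
      invℕ (denominator k) * (Π< (suc k) d * d (suc k))
        ≈⟨ *-assoc _ _ _ ⟨
      invℕ (denominator k) * Π< (suc k) d * d (suc k)
        ∎

  T-solvesChebyshev : ∀ γ → SolvesChebyshev γ (T γ)
  T-solvesChebyshev γ n = begin
    L (T γ) n                                                     ≈⟨ L-coefficient (T γ) n ⟩
    ⟦ recurrenceFactor n ⟧ * T γ (suc n) + ⟦ n ⟧ * ⟦ n ⟧ * T γ n  ≈⟨ +-congʳ (T-step γ n) ⟩
    T γ n * (γ * γ - ⟦ n ⟧ * ⟦ n ⟧) + ⟦ n ⟧ * ⟦ n ⟧ * T γ n        ≈⟨ x[y-z]+zx≈yx (T γ n) (γ * γ) (⟦ n ⟧ * ⟦ n ⟧) ⟩
    γ * γ * T γ n                                                 ≈⟨ constˢ-· (γ * γ) (T γ) n ⟨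
    (constˢ (γ * γ) · T γ) n                                      ∎

  T-cong : ∀ {α β} → α ≈ β → T α ≋ T β
  T-cong {α} {β} α≈β = chebyshev-unique α (T α) (T β) (T-solvesChebyshev α)
    (SolvesChebyshev-cong (T β) (sym α≈β) (T-solvesChebyshev β)) refl

  T-one : T 1# ≋ X
  T-one = chebyshev-unique 1# (T 1#) X (T-solvesChebyshev 1#) X-solvesChebyshev refl

module CompositionLaw {c ℓ : Level} (F : CharZeroField c ℓ) where
  open CharZeroField F
  open Series F
  open PowerSeriesSemiring F
  open Differentiation F
  open Composition F
  open ChebyshevEquation F
  open ChebyshevSeries F
  open import Algebra.Solver.Ring.NaturalCoefficients.Default powerSeriesSemiring using (solve; _:=_; _:+_; _:*_; con)
  open ≋-Reasoning

  ≋one+minusConst : ∀ g → g 0 ≈ 1# → g ≋ (one +ˢ minusConst g)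
  ≋one+minusConst g g₀≈1 zero    = trans g₀≈1 (sym (+-identityʳ 1#))
  ≋one+minusConst g g₀≈1 (suc n) = sym (+-identityˡ _)

  Q-zero : ∀ h → h 0 ≈ 0# → Q h 0 ≈ 0#
  Q-zero h h₀≈0 = trans (+-cong h₀h₀≈0 (trans (+-cong h₀≈0 h₀≈0) (+-identityʳ 0#))) (+-identityʳ 0#)
    where
    h₀h₀≈0 : (h · h) 0 ≈ 0#
    h₀h₀≈0 = trans (+-identityˡ _) (trans (*-congˡ h₀≈0) (zeroʳ _))

  Q·-zero : ∀ h f → h 0 ≈ 0# → (Q h · f) 0 ≈ 0#
  Q·-zero h f h₀≈0 = trans (+-identityˡ _) (trans (*-congʳ (Q-zero h h₀≈0)) (zeroˡ _))

  D-Q : ∀ h → D (Q h) ≋ (((one +ˢ h) +ˢ (one +ˢ h)) · D h)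
  D-Q h = begin
    D (h · h +ˢ (h +ˢ h))                    ≈⟨ PS.trans (D-+ˢ (h · h) (h +ˢ h)) (PS.+-cong (D-· h h) (D-+ˢ h h)) ⟩
    (D h · h +ˢ h · D h) +ˢ (D h +ˢ D h)     ≈⟨ solve 2 (λ h h′ → (h′ :* h :+ h :* h′) :+ (h′ :+ h′)
                                                           := ((con 1 :+ h) :+ (con 1 :+ h)) :* h′) PS.refl h (D h) ⟩
    ((one +ˢ h) +ˢ (one +ˢ h)) · D h         ∎

  QY·-∘ˢ : ∀ a g → ((Q Y · a) ∘ˢ g) ≋ (Q (minusConst g) · (a ∘ˢ g))
  QY·-∘ˢ a g = begin
    (Q Y · a) ∘ˢ g
      ≈⟨ ∘ˢ-cong g (solve 2 (λ y a → (y :* y :+ (y :+ y)) :* a := y :* (y :* a) :+ (y :* a :+ y :* a)) PS.refl Y a) ⟩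
    (Y · (Y · a) +ˢ (Y · a +ˢ Y · a)) ∘ˢ g
      ≈⟨ PS.trans (∘ˢ-+ˢ (Y · (Y · a)) (Y · a +ˢ Y · a) g) (+ˢ-congˡ ((Y · (Y · a)) ∘ˢ g) (∘ˢ-+ˢ (Y · a) (Y · a) g)) ⟩
    (Y · (Y · a)) ∘ˢ g +ˢ ((Y · a) ∘ˢ g +ˢ (Y · a) ∘ˢ g)
      ≈⟨ PS.+-cong (PS.trans (Y·-∘ˢ (Y · a) g) (·-congʳ h (Y·-∘ˢ a g))) (PS.+-cong (Y·-∘ˢ a g) (Y·-∘ˢ a g)) ⟩
    ((a ∘ˢ g) · h) · h +ˢ ((a ∘ˢ g) · h +ˢ (a ∘ˢ g) · h)
      ≈⟨ solve 2 (λ b h → b :* h :* h :+ (b :* h :+ b :* h) := (h :* h :+ (h :+ h)) :* b) PS.refl (a ∘ˢ g) h ⟩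
    Q h · (a ∘ˢ g)
      ∎
    where
    h : PowerSeries
    h = minusConst g

  X·-∘ˢ : ∀ a g → ((X · a) ∘ˢ g) ≋ ((one +ˢ minusConst g) · (a ∘ˢ g))
  X·-∘ˢ a g = begin
    (X · a) ∘ˢ g                      ≈⟨ ∘ˢ-cong g (PS.trans (·-congʳ a X≋one+Y) (solve 2 (λ y a → (con 1 :+ y) :* a := a :+ y :* a) PS.refl Y a)) ⟩
    (a +ˢ Y · a) ∘ˢ g                 ≈⟨ PS.trans (∘ˢ-+ˢ a (Y · a) g) (+ˢ-congˡ (a ∘ˢ g) (Y·-∘ˢ a g)) ⟩
    a ∘ˢ g +ˢ (a ∘ˢ g) · minusConst g ≈⟨ solve 2 (λ b h → b :+ b :* h := (con 1 :+ h) :* b) PS.refl (a ∘ˢ g) (minusConst g) ⟩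
    (one +ˢ minusConst g) · (a ∘ˢ g)  ∎

  constˢ-·-constˢ : ∀ a b → (constˢ a · constˢ b) ≋ constˢ (a * b)
  constˢ-·-constˢ a b zero    = constˢ-· a (constˢ b) 0
  constˢ-·-constˢ a b (suc n) = trans (constˢ-· a (constˢ b) (suc n)) (zeroʳ a)

  -- Both sides vanish at x = 1, and both derivatives are 2 u′ · β² u by the equation for u.
  first-integral : ∀ β → (Q Y · (D (T β) · D (T β))) ≋ (constˢ (β * β) · Q (minusConst (T β)))
  first-integral β = D-injective (PS.trans D-lhs (PS.sym D-rhs))
    (trans (Q·-zero Y (u′ · u′) refl) (sym (trans (PS.*-comm B (Q h) 0) (Q·-zero h B refl))))
    where
    u u′ u″ h B : PowerSeries
    u  = T β
    u′ = D u
    u″ = D u′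
    h  = minusConst u
    B  = constˢ (β * β)
    D-lhs : D (Q Y · (u′ · u′)) ≋ ((u′ +ˢ u′) · (B · u))
    D-lhs = begin
      D (Q Y · (u′ · u′))
        ≈⟨ D-· (Q Y) (u′ · u′) ⟩
      D (Q Y) · (u′ · u′) +ˢ Q Y · D (u′ · u′)
        ≈⟨ PS.+-cong (·-congʳ (u′ · u′) (PS.trans (D-Q Y) (·-congˡ ((one +ˢ Y) +ˢ (one +ˢ Y)) D-Y)))
                     (·-congˡ (Q Y) (D-· u′ u′)) ⟩
      (((one +ˢ Y) +ˢ (one +ˢ Y)) · one) · (u′ · u′) +ˢ Q Y · (u″ · u′ +ˢ u′ · u″)
        ≈⟨ solve 4 (λ y q d₁ d₂ → ((con 1 :+ y) :+ (con 1 :+ y)) :* con 1 :* (d₁ :* d₁) :+ q :* (d₂ :* d₁ :+ d₁ :* d₂)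
                                := (d₁ :+ d₁) :* (q :* d₂ :+ (con 1 :+ y) :* d₁)) PS.refl Y (Q Y) u′ u″ ⟩
      (u′ +ˢ u′) · (Q Y · u″ +ˢ (one +ˢ Y) · u′)
        ≈⟨ ·-congˡ (u′ +ˢ u′) (PS.trans (+ˢ-congˡ (Q Y · u″) (·-congʳ u′ (PS.sym X≋one+Y))) (T-solvesChebyshev β)) ⟩
      (u′ +ˢ u′) · (B · u)
        ∎
    D-rhs : D (B · Q h) ≋ ((u′ +ˢ u′) · (B · u))
    D-rhs = begin
      D (B · Q h)
        ≈⟨ D-· B (Q h) ⟩
      D B · Q h +ˢ B · D (Q h)
        ≈⟨ PS.+-cong (·-congʳ (Q h) (D-constˢ (β * β))) (·-congˡ B (D-Q h)) ⟩
      0ˢ · Q h +ˢ B · (((one +ˢ h) +ˢ (one +ˢ h)) · u′)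
        ≈⟨ solve 4 (λ q b h d → con 0 :* q :+ b :* (((con 1 :+ h) :+ (con 1 :+ h)) :* d)
                              := (d :+ d) :* (b :* (con 1 :+ h))) PS.refl (Q h) B h u′ ⟩
      (u′ +ˢ u′) · (B · (one +ˢ h))
        ≈⟨ ·-congˡ (u′ +ˢ u′) (·-congˡ B (PS.sym (≋one+minusConst u refl))) ⟩
      (u′ +ˢ u′) · (B · u)
        ∎

  ∘ˢ-solvesChebyshev : ∀ α β → SolvesChebyshev (α * β) (T α ∘ˢ T β)
  ∘ˢ-solvesChebyshev α β = begin
    Q Y · D (D S) +ˢ X · D S
      ≈⟨ PS.+-cong (·-congˡ (Q Y) D²S) (·-congˡ X (chain-rule f u)) ⟩
    Q Y · (((f″ ∘ˢ u) · u′) · u′ +ˢ (f′ ∘ˢ u) · u″) +ˢ X · ((f′ ∘ˢ u) · u′)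
      ≈⟨ solve 6 (λ q x a₂ a₁ d₁ d₂ → q :* (a₂ :* d₁ :* d₁ :+ a₁ :* d₂) :+ x :* (a₁ :* d₁)
                                   := a₂ :* (q :* (d₁ :* d₁)) :+ a₁ :* (q :* d₂ :+ x :* d₁)) PS.refl (Q Y) X (f″ ∘ˢ u) (f′ ∘ˢ u) u′ u″ ⟩
    (f″ ∘ˢ u) · (Q Y · (u′ · u′)) +ˢ (f′ ∘ˢ u) · L u
      ≈⟨ PS.+-cong (·-congˡ (f″ ∘ˢ u) (first-integral β))
                   (·-congˡ (f′ ∘ˢ u) (PS.trans (T-solvesChebyshev β) (·-congˡ B (≋one+minusConst u refl)))) ⟩
    (f″ ∘ˢ u) · (B · Q h) +ˢ (f′ ∘ˢ u) · (B · (one +ˢ h))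
      ≈⟨ solve 5 (λ a₂ a₁ b q h → a₂ :* (b :* q) :+ a₁ :* (b :* (con 1 :+ h))
                                := b :* (q :* a₂ :+ (con 1 :+ h) :* a₁)) PS.refl (f″ ∘ˢ u) (f′ ∘ˢ u) B (Q h) h ⟩
    B · (Q h · (f″ ∘ˢ u) +ˢ (one +ˢ h) · (f′ ∘ˢ u))
      ≈⟨ ·-congˡ B (PS.sym (PS.trans (∘ˢ-+ˢ (Q Y · f″) (X · f′) u) (PS.+-cong (QY·-∘ˢ f″ u) (X·-∘ˢ f′ u)))) ⟩
    B · (L f ∘ˢ u)
      ≈⟨ ·-congˡ B (PS.trans (∘ˢ-cong u (T-solvesChebyshev α)) (constˢ-·-∘ˢ (α * α) f u)) ⟩
    B · (constˢ (α * α) · S)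
      ≈⟨ PS.sym (PS.*-assoc B (constˢ (α * α)) S) ⟩
    (B · constˢ (α * α)) · S
      ≈⟨ ·-congʳ S (PS.trans (constˢ-·-constˢ (β * β) (α * α)) (constˢ-cong square-product)) ⟩
    constˢ (α * β * (α * β)) · S
      ∎
    where
    f f′ f″ u u′ u″ h B S : PowerSeries
    f  = T α
    f′ = D f
    f″ = D f′
    u  = T β
    u′ = D u
    u″ = D u′
    h  = minusConst u
    B  = constˢ (β * β)
    S  = f ∘ˢ u
    D²S : D (D S) ≋ (((f″ ∘ˢ u) · u′) · u′ +ˢ (f′ ∘ˢ u) · u″)
    D²S = begin
      D (D S)                                 ≈⟨ D-cong (chain-rule f u) ⟩
      D ((f′ ∘ˢ u) · u′)                      ≈⟨ D-· (f′ ∘ˢ u) u′ ⟩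
      D (f′ ∘ˢ u) · u′ +ˢ (f′ ∘ˢ u) · u″      ≈⟨ +ˢ-congʳ ((f′ ∘ˢ u) · u″) (·-congʳ u′ (chain-rule f′ u)) ⟩
      ((f″ ∘ˢ u) · u′) · u′ +ˢ (f′ ∘ˢ u) · u″   ∎
    square-product : β * β * (α * α) ≈ α * β * (α * β)
    square-product = solve-field 2 (λ a b → b :× b :× (a :× a) :≐ a :× b :× (a :× b)) refl α β
      where
      open import Algebra.Solver.Ring.NaturalCoefficients.Default commutativeSemiring
        using () renaming (solve to solve-field; _:*_ to _:×_; _:=_ to _:≐_)

  T-∘ˢ : ∀ α β → (T α ∘ˢ T β) ≋ T (α * β)
  T-∘ˢ α β = chebyshev-unique (α * β) (T α ∘ˢ T β) (T (α * β))
    (∘ˢ-solvesChebyshev α β) (T-solvesChebyshev (α * β)) (∘ˢ-zero (T α) (T β))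

  T-∘ˢ-inverse : ∀ α α′ → α * α′ ≈ 1# → (T α ∘ˢ T α′) ≋ X
  T-∘ˢ-inverse α α′ αα′≈1 n = trans (T-∘ˢ α α′ n) (trans (T-cong αα′≈1 n) (T-one n))

mainTheorem8 : {c ℓ : Level} (F : CharZeroField c ℓ) →
    let open CharZeroField F
        open Series F
    in ((α β : Carrier) → (T α ∘ˢ T β) ≋ T (α * β))
       × (T 1# ≋ X)
       × ((α α' : Carrier) → (α * α') ≈ 1# → ((T α ∘ˢ T α') ≋ X) × ((T α' ∘ˢ T α) ≋ X))
mainTheorem8 F = T-∘ˢ , T-one , λ α α′ αα′≈1 →
  T-∘ˢ-inverse α α′ αα′≈1 , T-∘ˢ-inverse α′ α (trans (*-comm α′ α) αα′≈1)
  where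
  open CharZeroField F using (trans; *-comm)
  open ChebyshevSeries F using (T-one)
  open CompositionLaw F using (T-∘ˢ; T-∘ˢ-inverse)
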